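{- Let $q$ be a prime power, $r$ a positive integer, $d$ a positive divisor of $q+1$, $\epsilon\in\mathbb F_{q^2}^*$ of order $d$. Let $a,b\in\mathbb F_{q^2}^*$ and integers $0<i_1<i_2<(q+1)/d$, $0\le j_1,j_2<d$ (so $h(X)=1+aX^{i_1+j_1(q+1)/d}+bX^{i_2+j_2(q+1)/d}$). For $0\le k<d$ let $L_k(X)=1+a\epsilon^{j_1k}X^{i_1}+b\epsilon^{j_2k}X^{i_2}$, $s_k=0$, $t_k=i_2$. Suppose that for some $k$, $\tau_k=0$, i.e. $L_k\in\mathcal L_k(i_2,0;\lambda_k)$ for some $\lambda_k\in\mu_{q+1}$; let $\pi(k)\in\mathbb Z/d\mathbb Z$ with $\lambda_k^{(q+1)/d}=\epsilon^{\pi(k)}$ and $e_k=r-2s_k-t_k+\tau_k$. Then $i_1=i_2/2$, $e_k=r-i_2$, $b=a^{1-q}\epsilon^{(2j_1-j_2)k}$, and $$\pi(k)=-2j_1k\frac{q+1}d+\alpha\quad\text{in }\mathbb Z/d\mathbb Z,$$ where $\alpha\in\mathbb Z/d\mathbb Z$ is given by $a^{(q^2-1)/d}=\epsilon^\alpha$.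
   Context: $\mu_{q+1}=\{x\in\mathbb F_{q^2}^*:x^{q+1}=1\}$. For $a\in\mathbb F_{q^2}$, $\bar a=a^q$; for $f=\sum_{i=0}^na_iX^i$ with $a_n\ne0$, $\tilde f(X)=\sum_{i=0}^n\bar a_iX^{n-i}$. For $0\le k<d$, $0\le t<(q+1)/d$, $\lambda\in\mu_{q+1}$: $\mathcal L_k(t,0;\lambda)$ is the set of $L\in\mathbb F_{q^2}[X]$ with $\deg L=t$, $\tilde L=\lambda L$ and $\gcd(L,X^{(q+1)/d}-\epsilon^k)=1$. -}

module Defs where

open import Level using (Level; _⊔_)
open import Data.Nat as ℕ using (ℕ; zero; suc; _≟_)
open import Data.Fin using (Fin)
open import Data.Integer as ℤ using (ℤ; +_; -[1+_])
open import Data.List using (List; []; _∷_; map; reverse; length; upTo)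
open import Data.Product using (Σ; ∃; _×_; _,_)
open import Relation.Nullary using (¬_; yes; no)
open import Relation.Binary.PropositionalEquality as ≡ using (_≡_)
open import Algebra.Bundles using (CommutativeRing)
open import Function.Bundles using (Inverse)

record Field (c ℓ : Level) : Set (Level.suc (c ⊔ ℓ)) where
  field
    commRing : CommutativeRing c ℓ
  open CommutativeRing commRing public
  field
    _⁻¹      : Carrier → Carrier
    1≉0      : ¬ (1# ≈ 0#)
    ⁻¹-inv   : ∀ x → ¬ (x ≈ 0#) → (x * (x ⁻¹)) ≈ 1#

record FiniteField (n : ℕ) (c ℓ : Level) : Set (Level.suc (c ⊔ ℓ)) where
  field
    fld : Field c ℓ
  open Field fld public
  field
    card : Inverse (≡.setoid (Fin n)) setoid

open import Data.Nat.Primality using (Prime)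
IsPrimePower : ℕ → Set
IsPrimePower q = Σ ℕ λ p → Σ ℕ λ m → Prime p × (1 ℕ.≤ m) × (q ≡ p ℕ.^ m)

module FieldOps {c ℓ} (F : Field c ℓ) where
  open Field F

  _^_ : Carrier → ℕ → Carrier
  x ^ zero = 1#
  x ^ suc n = x * (x ^ n)

  -- integer powers (meaningful for nonzero x)
  _^ℤ_ : Carrier → ℤ → Carrier
  x ^ℤ (+ n) = x ^ n
  x ^ℤ -[1+ n ] = (x ⁻¹) ^ suc n

  HasOrder : Carrier → ℕ → Set ℓ
  HasOrder e d = ((e ^ d) ≈ 1#) × (∀ m → 0 ℕ.< m → m ℕ.< d → ¬ ((e ^ m) ≈ 1#))

  -- polynomials: coefficient lists, lowest degree first
  Poly : Set c
  Poly = List Carrier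

  coeff : Poly → ℕ → Carrier
  coeff [] _ = 0#
  coeff (a ∷ f) zero = a
  coeff (a ∷ f) (suc n) = coeff f n

  -- equality of polynomials (as coefficient sequences; trailing zeros ignored)
  _≈ₚ_ : Poly → Poly → Set ℓ
  f ≈ₚ g = ∀ n → coeff f n ≈ coeff g n

  fromCoeffs : ℕ → (ℕ → Carrier) → Poly
  fromCoeffs n f = map f (upTo n)

  addP : Poly → Poly → Poly
  addP [] g = g
  addP f [] = f
  addP (a ∷ f) (b ∷ g) = (a + b) ∷ addP f g

  mulP : Poly → Poly → Poly
  mulP [] g = []
  mulP (a ∷ f) g = addP (map (a *_) g) (0# ∷ mulP f g)

  scaleP : Carrier → Poly → Poly
  scaleP λ' f = map (λ' *_) f

  leading : Poly → Carrier
  leading [] = 0#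
  leading (a ∷ []) = a
  leading (a ∷ b ∷ f) = leading (b ∷ f)

  HasDegree : Poly → ℕ → Set (c ⊔ ℓ)
  HasDegree f t = Level.Lift c ((length f ≡ suc t) × ¬ (leading f ≈ 0#))

  _∣ₚ_ : Poly → Poly → Set (c ⊔ ℓ)
  g ∣ₚ f = Σ Poly λ h → mulP g h ≈ₚ f

  Coprime : Poly → Poly → Set (Level.suc (c ⊔ ℓ))
  Coprime f g = Level.Lift (Level.suc (c ⊔ ℓ)) (∀ h → h ∣ₚ f → h ∣ₚ g → h ∣ₚ (1# ∷ []))

module FFOps {n c ℓ} (q : ℕ) (F : FiniteField n c ℓ) where
  open FiniteField F
  open FieldOps fld public

  conj : Carrier → Carrier
  conj x = x ^ q

  -- f̃(X) = Σ ā_i X^{deg f - i}  (f given with nonzero leading coefficient)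
  tildeP : Poly → Poly
  tildeP f = reverse (map conj f)

  Inμ : Carrier → Set ℓ
  Inμ x = (x ^ (q ℕ.+ 1)) ≈ 1#

  InCalL : (ε : Carrier) (m k t : ℕ) (λ' : Carrier) (L : Poly) → Set (Level.suc (c ⊔ ℓ))
  InCalL ε m k t λ' L =
    HasDegree L t × Level.Lift (Level.suc (c ⊔ ℓ)) (tildeP L ≈ₚ scaleP λ' L)
    × Coprime L (fromCoeffs (suc m) (λ i → cf i))
    where
      cf : ℕ → Carrier
      cf zero = - (ε ^ k)
      cf (suc i) with suc i ≟ m
      ... | yes _ = 1#
      ... | no _ = 0#

  Lk : (ε a b : Carrier) (i₁ i₂ j₁ j₂ k : ℕ) → Poly
  Lk ε a b i₁ i₂ j₁ j₂ k = fromCoeffs (suc i₂) cf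
    where
      cf : ℕ → Carrier
      cf i with i ≟ 0 | i ≟ i₁ | i ≟ i₂
      ... | yes _ | _ | _ = 1#
      ... | no _ | yes _ | _ = a * (ε ^ (j₁ ℕ.* k))
      ... | no _ | no _ | yes _ = b * (ε ^ (j₂ ℕ.* k))
      ... | no _ | no _ | no _ = 0#

  eVal : (r s t τ : ℕ) → ℤ
  eVal r s t τ = ((+ r) ℤ.- (+ (2 ℕ.* s))) ℤ.- (+ t) ℤ.+ (+ τ)

-- Compare coefficients in L̃ = λ L for L = 1 + A X^i₁ + B X^i₂. At X^i₁ the right
-- side is λ A ≠ 0, the conjugate of the coefficient of X^(i₂ - i₁) in L, so
-- i₂ - i₁ = i₁ and A^q = λ A, i.e. λ = A^(q-1); at X^i₂ we get λ B = 1. Writing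
-- A = a ε^(j₁k), B = b ε^(j₂k) and using ε^(q+1) = 1 gives the formula for b;
-- raising λ = A^(q-1) to the power m = (q+1)/d and reading exponents of ε modulo
-- its order d gives the formula for π(k).
module Submission where

open import Defs
open import Level using (Level; lift)
open import Function using (_∘_)
open import Data.Nat as ℕ using (ℕ; zero; suc; _<_; _≤_; NonZero; _/_; _%_; _∸_; z≤n; s≤s)
import Data.Nat.Properties as ℕP
open import Data.Nat.DivMod using (m≡m%n+[m/n]*n; m%n<n; m*n/n≡m; m/n*n≡m)
open import Data.Nat.Divisibility using (_∣_; n∣m*n)
open import Data.Nat.Primality using (prime⇒nonZero)
open import Data.Nat.Tactic.RingSolver using (solve-∀)
open import Data.Fin using (Fin; toℕ)
open import Data.Integer as ℤ using (+_; _⊖_)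
import Data.Integer.Properties as ℤP
open import Data.Integer.Divisibility as ℤD using ()
import Data.Integer.Tactic.RingSolver as ℤSolver
open import Data.List using ([]; _∷_; _∷ʳ_; map; reverse; length; upTo; applyUpTo)
import Data.List.Properties as ListP
open import Data.Product using (_×_; _,_; proj₁; proj₂; ∃)
open import Data.Sum using (inj₁; inj₂)
open import Data.Empty using (⊥-elim)
open import Relation.Nullary using (¬_; yes; no)
open import Relation.Binary.Definitions using (tri<; tri≈; tri>)
open import Relation.Binary.PropositionalEquality as ≡ using (_≡_)

pos⇒suc : ∀ {n} → 0 < n → ∃ λ n′ → n ≡ suc n′
pos⇒suc (s≤s z≤n) = _ , ≡.refl

primePower⇒suc : ∀ {q} → IsPrimePower q → ∃ λ q′ → q ≡ suc q′
primePower⇒suc (p , e , p-prime , _ , ≡.refl) = pos⇒suc (ℕP.m^n>0 p {{prime⇒nonZero p-prime}} e)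

n∸m≡m⇒2m≡n : ∀ {m n} → n ∸ m ≡ m → m ≤ n → 2 ℕ.* m ≡ n
n∸m≡m⇒2m≡n {m} {n} n∸m≡m m≤n = begin
  2 ℕ.* m         ≡⟨ ≡.cong (m ℕ.+_) (ℕP.+-identityʳ m) ⟩
  m ℕ.+ m         ≡⟨ ≡.cong (m ℕ.+_) n∸m≡m ⟨
  m ℕ.+ (n ∸ m)   ≡⟨ ℕP.m+[n∸m]≡n m≤n ⟩
  n               ∎
  where open ≡.≡-Reasoning

m*m∸1≡[m∸1]*[m+1] : ∀ m → m ℕ.* m ∸ 1 ≡ (m ∸ 1) ℕ.* (m ℕ.+ 1)
m*m∸1≡[m∸1]*[m+1] zero    = ≡.refl
m*m∸1≡[m∸1]*[m+1] (suc m) = identity m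
  where
  identity : ∀ m → m ℕ.+ m ℕ.* suc m ≡ m ℕ.* (suc m ℕ.+ 1)
  identity = solve-∀

[q*q∸1]/d≡[q∸1]*m : ∀ q m d .{{_ : NonZero d}} → q ℕ.+ 1 ≡ m ℕ.* d → (q ℕ.* q ∸ 1) / d ≡ (q ∸ 1) ℕ.* m
[q*q∸1]/d≡[q∸1]*m q m d q+1≡md = begin
  (q ℕ.* q ∸ 1) / d                ≡⟨ ≡.cong (_/ d) (m*m∸1≡[m∸1]*[m+1] q) ⟩
  (q ∸ 1) ℕ.* (q ℕ.+ 1) / d        ≡⟨ ≡.cong (λ n → (q ∸ 1) ℕ.* n / d) q+1≡md ⟩
  (q ∸ 1) ℕ.* (m ℕ.* d) / d        ≡⟨ ≡.cong (_/ d) (ℕP.*-assoc (q ∸ 1) m d) ⟨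
  (q ∸ 1) ℕ.* m ℕ.* d / d          ≡⟨ m*n/n≡m ((q ∸ 1) ℕ.* m) d ⟩
  (q ∸ 1) ℕ.* m                    ∎
  where open ≡.≡-Reasoning

%≡⇒∣- : ∀ {x y d} .{{_ : NonZero d}} → x % d ≡ y % d → + d ℤD.∣ + x ℤ.- + y
%≡⇒∣- {x} {y} {d} x%d≡y%d =
  ≡.subst (λ z → d ∣ ℤ.∣ z ∣) (≡.sym difference)
    (≡.subst (d ∣_) (≡.sym (ℤP.abs-* (+ (x / d) ℤ.- + (y / d)) (+ d))) (n∣m*n ℤ.∣ + (x / d) ℤ.- + (y / d) ∣))
  where
  open ≡.≡-Reasoning
  lift-+* : ∀ r s → + (r ℕ.+ s ℕ.* d) ≡ + r ℤ.+ + s ℤ.* + d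
  lift-+* r s = ≡.trans (ℤP.pos-+ r (s ℕ.* d)) (≡.cong (λ z → + r ℤ.+ z) (ℤP.pos-* s d))
  cancel-remainder : ∀ r u v w → (r ℤ.+ u ℤ.* w) ℤ.- (r ℤ.+ v ℤ.* w) ≡ (u ℤ.- v) ℤ.* w
  cancel-remainder = ℤSolver.solve-∀
  difference : + x ℤ.- + y ≡ (+ (x / d) ℤ.- + (y / d)) ℤ.* + d
  difference = begin
    + x ℤ.- + y
      ≡⟨ ≡.cong₂ (λ u v → + u ℤ.- + v) (m≡m%n+[m/n]*n x d)
           (≡.trans (m≡m%n+[m/n]*n y d) (≡.cong (ℕ._+ y / d ℕ.* d) (≡.sym x%d≡y%d))) ⟩
    + (x % d ℕ.+ x / d ℕ.* d) ℤ.- + (x % d ℕ.+ y / d ℕ.* d)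
      ≡⟨ ≡.cong₂ ℤ._-_ (lift-+* (x % d) (x / d)) (lift-+* (x % d) (y / d)) ⟩
    (+ (x % d) ℤ.+ + (x / d) ℤ.* + d) ℤ.- (+ (x % d) ℤ.+ + (y / d) ℤ.* + d)
      ≡⟨ cancel-remainder (+ (x % d)) (+ (x / d)) (+ (y / d)) (+ d) ⟩
    (+ (x / d) ℤ.- + (y / d)) ℤ.* + d ∎

1-[1+n]≡0⊖n : ∀ n → + 1 ℤ.- + suc n ≡ 0 ⊖ n
1-[1+n]≡0⊖n n = ≡.trans (ℤP.[+m]-[+n]≡m⊖n 1 (suc n)) (ℤP.[1+m]⊖[1+n]≡m⊖n 0 n)

pos-2*m*n : ∀ m n → + (2 ℕ.* m ℕ.* n) ≡ + 2 ℤ.* + m ℤ.* + n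
pos-2*m*n m n = ≡.trans (ℤP.pos-* (2 ℕ.* m) n) (≡.cong (ℤ._* + n) (ℤP.pos-* 2 m))

[2m-n]o≡2mo⊖no : ∀ m n o → (+ 2 ℤ.* + m ℤ.- + n) ℤ.* + o ≡ 2 ℕ.* m ℕ.* o ⊖ n ℕ.* o
[2m-n]o≡2mo⊖no m n o = begin
  (+ 2 ℤ.* + m ℤ.- + n) ℤ.* + o               ≡⟨ distribute (+ 2 ℤ.* + m) (+ n) (+ o) ⟩
  + 2 ℤ.* + m ℤ.* + o ℤ.- + n ℤ.* + o          ≡⟨ ≡.cong₂ ℤ._-_ (pos-2*m*n m o) (ℤP.pos-* n o) ⟨
  + (2 ℕ.* m ℕ.* o) ℤ.- + (n ℕ.* o)            ≡⟨ ℤP.[+m]-[+n]≡m⊖n (2 ℕ.* m ℕ.* o) (n ℕ.* o) ⟩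
  2 ℕ.* m ℕ.* o ⊖ n ℕ.* o                      ∎
  where
  open ≡.≡-Reasoning
  distribute : ∀ x y z → (x ℤ.- y) ℤ.* z ≡ x ℤ.* z ℤ.- y ℤ.* z
  distribute = ℤSolver.solve-∀

p-[-2mno+a]≡[p+2mno]-a : ∀ p m n o a
  → + p ℤ.- (ℤ.- (+ 2 ℤ.* + m ℤ.* + n ℤ.* + o) ℤ.+ + a) ≡ + (p ℕ.+ 2 ℕ.* m ℕ.* n ℕ.* o) ℤ.- + a
p-[-2mno+a]≡[p+2mno]-a p m n o a = begin
  + p ℤ.- (ℤ.- (+ 2 ℤ.* + m ℤ.* + n ℤ.* + o) ℤ.+ + a)   ≡⟨ regroup (+ p) (+ 2 ℤ.* + m ℤ.* + n ℤ.* + o) (+ a) ⟩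
  (+ p ℤ.+ + 2 ℤ.* + m ℤ.* + n ℤ.* + o) ℤ.- + a        ≡⟨ ≡.cong (λ x → (+ p ℤ.+ x ℤ.- + a)) lift-2mno ⟨
  (+ p ℤ.+ + (2 ℕ.* m ℕ.* n ℕ.* o)) ℤ.- + a            ≡⟨ ≡.cong (ℤ._- + a) (ℤP.pos-+ p (2 ℕ.* m ℕ.* n ℕ.* o)) ⟨
  + (p ℕ.+ 2 ℕ.* m ℕ.* n ℕ.* o) ℤ.- + a                ∎
  where
  open ≡.≡-Reasoning
  regroup : ∀ x y z → x ℤ.- (ℤ.- y ℤ.+ z) ≡ (x ℤ.+ y) ℤ.- z
  regroup = ℤSolver.solve-∀
  lift-2mno : + (2 ℕ.* m ℕ.* n ℕ.* o) ≡ + 2 ℤ.* + m ℤ.* + n ℤ.* + o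
  lift-2mno = ≡.trans (ℤP.pos-* (2 ℕ.* m ℕ.* n) o) (≡.cong (ℤ._* + o) (pos-2*m*n m n))

module FieldProperties {c ℓ} (F : Field c ℓ) where
  open Field F
  open FieldOps F
  open import Relation.Binary.Reasoning.Setoid setoid
  import Algebra.Properties.CommutativeSemiring.Exp commutativeSemiring as Exp

  ^≡Exp^ : ∀ x n → x ^ n ≡ x Exp.^ n
  ^≡Exp^ x zero    = ≡.refl
  ^≡Exp^ x (suc n) = ≡.cong (x *_) (^≡Exp^ x n)

  ^-cong : ∀ {x y} n → x ≈ y → x ^ n ≈ y ^ n
  ^-cong {x} {y} n x≈y rewrite ^≡Exp^ x n | ^≡Exp^ y n = Exp.^-congˡ n x≈y

  ^-homo-* : ∀ x m n → x ^ (m ℕ.+ n) ≈ x ^ m * x ^ n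
  ^-homo-* x m n rewrite ^≡Exp^ x (m ℕ.+ n) | ^≡Exp^ x m | ^≡Exp^ x n = Exp.^-homo-* x m n

  ^-assocʳ : ∀ x m n → (x ^ m) ^ n ≈ x ^ (m ℕ.* n)
  ^-assocʳ x m n rewrite ^≡Exp^ x m | ^≡Exp^ (x Exp.^ m) n | ^≡Exp^ x (m ℕ.* n) = Exp.^-assocʳ x m n

  ^-distrib-* : ∀ x y n → (x * y) ^ n ≈ x ^ n * y ^ n
  ^-distrib-* x y n rewrite ^≡Exp^ (x * y) n | ^≡Exp^ x n | ^≡Exp^ y n = Exp.^-distrib-* x y n

  1^n≈1 : ∀ n → 1# ^ n ≈ 1#
  1^n≈1 zero    = refl
  1^n≈1 (suc n) = trans (*-identityˡ _) (1^n≈1 n)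

  ⁻¹-inverseˡ : ∀ {x} → ¬ x ≈ 0# → x ⁻¹ * x ≈ 1#
  ⁻¹-inverseˡ {x} x≉0 = trans (*-comm _ _) (⁻¹-inv x x≉0)

  *-cancelˡ-nonzero : ∀ {x y z} → ¬ x ≈ 0# → x * y ≈ x * z → y ≈ z
  *-cancelˡ-nonzero {x} {y} {z} x≉0 xy≈xz = begin
    y                ≈⟨ *-identityˡ y ⟨
    1# * y           ≈⟨ *-congʳ (⁻¹-inverseˡ x≉0) ⟨
    (x ⁻¹ * x) * y   ≈⟨ *-assoc _ _ _ ⟩
    x ⁻¹ * (x * y)   ≈⟨ *-congˡ xy≈xz ⟩
    x ⁻¹ * (x * z)   ≈⟨ *-assoc _ _ _ ⟨
    (x ⁻¹ * x) * z   ≈⟨ *-congʳ (⁻¹-inverseˡ x≉0) ⟩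
    1# * z           ≈⟨ *-identityˡ z ⟩
    z                ∎

  *-nonzero : ∀ {x y} → ¬ x ≈ 0# → ¬ y ≈ 0# → ¬ x * y ≈ 0#
  *-nonzero {x} x≉0 y≉0 xy≈0 = y≉0 (*-cancelˡ-nonzero x≉0 (trans xy≈0 (sym (zeroʳ x))))

  ^-nonzero : ∀ {x} n → ¬ x ≈ 0# → ¬ x ^ n ≈ 0#
  ^-nonzero zero    _   = 1≉0
  ^-nonzero (suc n) x≉0 = *-nonzero x≉0 (^-nonzero n x≉0)

  *≈1⇒nonzero : ∀ {x y} → x * y ≈ 1# → ¬ x ≈ 0#
  *≈1⇒nonzero {x} {y} xy≈1 x≈0 = 1≉0 (trans (sym xy≈1) (trans (*-congʳ x≈0) (zeroˡ y)))

  0^suc≈0 : ∀ n → 0# ^ suc n ≈ 0#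
  0^suc≈0 n = zeroˡ _

  ^ℤ-neg-inverse : ∀ {x} n → ¬ x ≈ 0# → x ^ℤ (ℤ.- + n) * x ^ n ≈ 1#
  ^ℤ-neg-inverse zero    _   = *-identityˡ 1#
  ^ℤ-neg-inverse {x} (suc n) x≉0 = begin
    (x ⁻¹) ^ suc n * x ^ suc n  ≈⟨ ^-distrib-* _ _ (suc n) ⟨
    (x ⁻¹ * x) ^ suc n          ≈⟨ ^-cong (suc n) (⁻¹-inverseˡ x≉0) ⟩
    1# ^ suc n                  ≈⟨ 1^n≈1 (suc n) ⟩
    1#                          ∎

  ^ℤ-⊖ : ∀ {x} m n → ¬ x ≈ 0# → x ^ℤ (m ⊖ n) * x ^ n ≈ x ^ m
  ^ℤ-⊖ {x} m n x≉0 with ℕP.≤-total n m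
  ... | inj₁ n≤m = begin
    x ^ℤ (m ⊖ n) * x ^ n   ≡⟨ ≡.cong (λ z → x ^ℤ z * x ^ n) (ℤP.⊖-≥ n≤m) ⟩
    x ^ (m ∸ n) * x ^ n    ≈⟨ ^-homo-* x (m ∸ n) n ⟨
    x ^ (m ∸ n ℕ.+ n)      ≡⟨ ≡.cong (x ^_) (ℕP.m∸n+n≡m n≤m) ⟩
    x ^ m                  ∎
  ... | inj₂ m≤n = begin
    x ^ℤ (m ⊖ n) * x ^ n                        ≡⟨ ≡.cong (λ z → x ^ℤ z * x ^ n) (ℤP.⊖-≤ m≤n) ⟩
    x ^ℤ (ℤ.- + (n ∸ m)) * x ^ n                ≡⟨ ≡.cong (λ e → x ^ℤ (ℤ.- + (n ∸ m)) * x ^ e) (ℕP.m∸n+n≡m m≤n) ⟨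
    x ^ℤ (ℤ.- + (n ∸ m)) * x ^ (n ∸ m ℕ.+ m)    ≈⟨ *-congˡ (^-homo-* x (n ∸ m) m) ⟩
    x ^ℤ (ℤ.- + (n ∸ m)) * (x ^ (n ∸ m) * x ^ m) ≈⟨ *-assoc _ _ _ ⟨
    (x ^ℤ (ℤ.- + (n ∸ m)) * x ^ (n ∸ m)) * x ^ m ≈⟨ *-congʳ (^ℤ-neg-inverse (n ∸ m) x≉0) ⟩
    1# * x ^ m                                  ≈⟨ *-identityˡ _ ⟩
    x ^ m                                       ∎

  ^-multiple≈1 : ∀ {x} p t → x ^ p ≈ 1# → x ^ (t ℕ.* p) ≈ 1#
  ^-multiple≈1 {x} p t x^p≈1 = begin
    x ^ (t ℕ.* p)   ≡⟨ ≡.cong (x ^_) (ℕP.*-comm t p) ⟩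
    x ^ (p ℕ.* t)   ≈⟨ ^-assocʳ x p t ⟨
    (x ^ p) ^ t     ≈⟨ ^-cong t x^p≈1 ⟩
    1# ^ t          ≈⟨ 1^n≈1 t ⟩
    1#              ∎

  ^-periodic : ∀ {x} p n t → x ^ p ≈ 1# → x ^ (n ℕ.+ t ℕ.* p) ≈ x ^ n
  ^-periodic {x} p n t x^p≈1 = begin
    x ^ (n ℕ.+ t ℕ.* p)    ≈⟨ ^-homo-* x n (t ℕ.* p) ⟩
    x ^ n * x ^ (t ℕ.* p)  ≈⟨ *-congˡ (^-multiple≈1 p t x^p≈1) ⟩
    x ^ n * 1#             ≈⟨ *-identityʳ _ ⟩
    x ^ n                  ∎

  ^≈1⇒nonzero : ∀ {x} n .{{_ : NonZero n}} → x ^ n ≈ 1# → ¬ x ≈ 0#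
  ^≈1⇒nonzero (suc n) = *≈1⇒nonzero

  module Order {ε : Carrier} {d : ℕ} .{{_ : NonZero d}} (ε-order : HasOrder ε d) where

    ε≉0 : ¬ ε ≈ 0#
    ε≉0 = ^≈1⇒nonzero d (proj₁ ε-order)

    ^-reduce-% : ∀ n → ε ^ n ≈ ε ^ (n % d)
    ^-reduce-% n = begin
      ε ^ n                        ≡⟨ ≡.cong (ε ^_) (m≡m%n+[m/n]*n n d) ⟩
      ε ^ (n % d ℕ.+ n / d ℕ.* d)   ≈⟨ ^-periodic d (n % d) (n / d) (proj₁ ε-order) ⟩
      ε ^ (n % d)                  ∎

    ^-distinct-< : ∀ {u v} → u < v → v < d → ¬ ε ^ u ≈ ε ^ v
    ^-distinct-< {u} {v} u<v v<d ε^u≈ε^v =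
      proj₂ ε-order (v ∸ u) (ℕP.m<n⇒0<n∸m u<v) (ℕP.≤-<-trans (ℕP.m∸n≤m v u) v<d) ε^[v∸u]≈1
      where
      ε^[v∸u]≈1 : ε ^ (v ∸ u) ≈ 1#
      ε^[v∸u]≈1 = *-cancelˡ-nonzero (^-nonzero u ε≉0) (begin
        ε ^ u * ε ^ (v ∸ u)  ≈⟨ ^-homo-* ε u (v ∸ u) ⟨
        ε ^ (u ℕ.+ (v ∸ u))  ≡⟨ ≡.cong (ε ^_) (ℕP.m+[n∸m]≡n (ℕP.<⇒≤ u<v)) ⟩
        ε ^ v                ≈⟨ ε^u≈ε^v ⟨
        ε ^ u                ≈⟨ *-identityʳ _ ⟨
        ε ^ u * 1#           ∎)

    ^-injective-< : ∀ {u v} → u < d → v < d → ε ^ u ≈ ε ^ v → u ≡ v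
    ^-injective-< {u} {v} u<d v<d ε^u≈ε^v with ℕP.<-cmp u v
    ... | tri< u<v _ _ = ⊥-elim (^-distinct-< u<v v<d ε^u≈ε^v)
    ... | tri≈ _ u≡v _ = u≡v
    ... | tri> _ _ v<u = ⊥-elim (^-distinct-< v<u u<d (sym ε^u≈ε^v))

    ^-injective-% : ∀ {x y} → ε ^ x ≈ ε ^ y → x % d ≡ y % d
    ^-injective-% {x} {y} ε^x≈ε^y = ^-injective-< (m%n<n x d) (m%n<n y d)
      (trans (sym (^-reduce-% x)) (trans ε^x≈ε^y (^-reduce-% y)))

module Coefficients {c ℓ} (F : Field c ℓ) where
  open Field F using (Carrier)
  open FieldOps F

  coeff-applyUpTo : ∀ (f : ℕ → Carrier) {n i} → i < n → coeff (applyUpTo f n) i ≡ f i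
  coeff-applyUpTo f {suc n} {zero}  _         = ≡.refl
  coeff-applyUpTo f {suc n} {suc i} (s≤s i<n) = coeff-applyUpTo (f ∘ suc) i<n

  -- Stated for any p equal to fromCoeffs n f so that f is found by unification
  -- even when it is a local (where-bound) function, as in Lk.
  coeff-fromCoeffs : ∀ {f : ℕ → Carrier} {n i} p → p ≡ fromCoeffs n f → i < n → coeff p i ≡ f i
  coeff-fromCoeffs {f} {n} {i} _ ≡.refl i<n =
    ≡.trans (≡.cong (λ p → coeff p i) (ListP.map-upTo f n)) (coeff-applyUpTo f i<n)

  length-fromCoeffs : ∀ (f : ℕ → Carrier) n → length (fromCoeffs n f) ≡ n
  length-fromCoeffs f n = ≡.trans (ListP.length-map f (upTo n)) (ListP.length-upTo n)

  coeff-map : ∀ (h : Carrier → Carrier) xs {i} → i < length xs → coeff (map h xs) i ≡ h (coeff xs i)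
  coeff-map h (x ∷ xs) {zero}  _         = ≡.refl
  coeff-map h (x ∷ xs) {suc i} (s≤s i<n) = coeff-map h xs i<n

  coeff-∷ʳ-< : ∀ ys y {i} → i < length ys → coeff (ys ∷ʳ y) i ≡ coeff ys i
  coeff-∷ʳ-< (x ∷ ys) y {zero}  _         = ≡.refl
  coeff-∷ʳ-< (x ∷ ys) y {suc i} (s≤s i<n) = coeff-∷ʳ-< ys y i<n

  coeff-∷ʳ-length : ∀ ys y → coeff (ys ∷ʳ y) (length ys) ≡ y
  coeff-∷ʳ-length []       y = ≡.refl
  coeff-∷ʳ-length (x ∷ ys) y = coeff-∷ʳ-length ys y

  coeff-reverse : ∀ xs {i} → i < length xs → coeff (reverse xs) i ≡ coeff xs (length xs ∸ suc i)
  coeff-reverse (x ∷ xs) {i} (s≤s i≤n) rewrite ListP.unfold-reverse x xs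
    with ℕP.m≤n⇒m<n∨m≡n i≤n
  ... | inj₁ i<n = begin
    coeff (reverse xs ∷ʳ x) i              ≡⟨ coeff-∷ʳ-< (reverse xs) x (≡.subst (i <_) (≡.sym (ListP.length-reverse xs)) i<n) ⟩
    coeff (reverse xs) i                   ≡⟨ coeff-reverse xs i<n ⟩
    coeff xs (length xs ∸ suc i)           ≡⟨ ≡.cong (coeff (x ∷ xs)) (ℕP.+-∸-assoc 1 i<n) ⟨
    coeff (x ∷ xs) (length xs ∸ i)         ∎
    where open ≡.≡-Reasoning
  ... | inj₂ ≡.refl = begin
    coeff (reverse xs ∷ʳ x) (length xs)             ≡⟨ ≡.cong (coeff (reverse xs ∷ʳ x)) (ListP.length-reverse xs) ⟨
    coeff (reverse xs ∷ʳ x) (length (reverse xs))   ≡⟨ coeff-∷ʳ-length (reverse xs) x ⟩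
    x                                               ≡⟨ ≡.cong (coeff (x ∷ xs)) (ℕP.n∸n≡0 (length xs)) ⟨
    coeff (x ∷ xs) (length xs ∸ length xs)          ∎
    where open ≡.≡-Reasoning

module Reciprocity {N c ℓ} (q : ℕ) (F : FiniteField N c ℓ) where
  open FiniteField F
  open FFOps q F
  open Coefficients fld

  coeff-tildeP : ∀ f {t i} → length f ≡ suc t → i ≤ t → coeff (tildeP f) i ≡ conj (coeff f (t ∸ i))
  coeff-tildeP f {t} {i} len≡1+t i≤t = begin
    coeff (reverse (map conj f)) i                       ≡⟨ coeff-reverse (map conj f) (≡.subst (i <_) (≡.sym len-map) (s≤s i≤t)) ⟩
    coeff (map conj f) (length (map conj f) ∸ suc i)      ≡⟨ ≡.cong (λ n → coeff (map conj f) (n ∸ suc i)) len-map ⟩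
    coeff (map conj f) (t ∸ i)                           ≡⟨ coeff-map conj f (≡.subst (t ∸ i <_) (≡.sym len≡1+t) (s≤s (ℕP.m∸n≤m t i))) ⟩
    conj (coeff f (t ∸ i))                               ∎
    where
    open ≡.≡-Reasoning
    len-map : length (map conj f) ≡ suc t
    len-map = ≡.trans (ListP.length-map conj f) len≡1+t

  reciprocal-coeff : ∀ {λ′ f t i} → tildeP f ≈ₚ scaleP λ′ f → length f ≡ suc t → i ≤ t
                   → conj (coeff f (t ∸ i)) ≈ λ′ * coeff f i
  reciprocal-coeff {λ′} {f} {t} {i} f̃≈λf len≡1+t i≤t =
    trans (reflexive (≡.sym (coeff-tildeP f len≡1+t i≤t)))
      (trans (f̃≈λf i) (reflexive (coeff-map (λ′ *_) f (≡.subst (i <_) (≡.sym len≡1+t) (s≤s i≤t)))))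

  module _ {ε a b : Carrier} {i₁ i₂ j₁ j₂ k : ℕ} where

    length-Lk : length (Lk ε a b i₁ i₂ j₁ j₂ k) ≡ suc i₂
    length-Lk = length-fromCoeffs _ _

    coeff-Lk-i₁ : 0 < i₁ → i₁ < i₂ → coeff (Lk ε a b i₁ i₂ j₁ j₂ k) i₁ ≡ a * ε ^ (j₁ ℕ.* k)
    coeff-Lk-i₁ 0<i₁ i₁<i₂ rewrite coeff-fromCoeffs (Lk ε a b i₁ i₂ j₁ j₂ k) ≡.refl (ℕP.m<n⇒m<1+n i₁<i₂)
      with i₁ ℕ.≟ 0 | i₁ ℕ.≟ i₁
    ... | yes i₁≡0 | _        = ⊥-elim (ℕP.<⇒≢ 0<i₁ (≡.sym i₁≡0))
    ... | no _     | yes _    = ≡.refl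
    ... | no _     | no i₁≢i₁ = ⊥-elim (i₁≢i₁ ≡.refl)

    coeff-Lk-i₂ : 0 < i₁ → i₁ < i₂ → coeff (Lk ε a b i₁ i₂ j₁ j₂ k) i₂ ≡ b * ε ^ (j₂ ℕ.* k)
    coeff-Lk-i₂ 0<i₁ i₁<i₂ rewrite coeff-fromCoeffs (Lk ε a b i₁ i₂ j₁ j₂ k) ≡.refl (ℕP.n<1+n i₂)
      with i₂ ℕ.≟ 0 | i₂ ℕ.≟ i₁ | i₂ ℕ.≟ i₂
    ... | yes i₂≡0 | _        | _        = ⊥-elim (ℕP.<⇒≢ (ℕP.<-trans 0<i₁ i₁<i₂) (≡.sym i₂≡0))
    ... | no _     | yes i₂≡i₁ | _       = ⊥-elim (ℕP.<⇒≢ i₁<i₂ (≡.sym i₂≡i₁))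
    ... | no _     | no _     | yes _    = ≡.refl
    ... | no _     | no _     | no i₂≢i₂ = ⊥-elim (i₂≢i₂ ≡.refl)

    coeff-Lk-other : ∀ {i} → i ≤ i₂ → ¬ i ≡ 0 → ¬ i ≡ i₁ → ¬ i ≡ i₂ → coeff (Lk ε a b i₁ i₂ j₁ j₂ k) i ≡ 0#
    coeff-Lk-other {i} i≤i₂ i≢0 i≢i₁ i≢i₂ rewrite coeff-fromCoeffs (Lk ε a b i₁ i₂ j₁ j₂ k) ≡.refl (s≤s i≤i₂)
      with i ℕ.≟ 0 | i ℕ.≟ i₁ | i ℕ.≟ i₂
    ... | yes i≡0 | _        | _        = ⊥-elim (i≢0 i≡0)
    ... | no _    | yes i≡i₁ | _        = ⊥-elim (i≢i₁ i≡i₁)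
    ... | no _    | no _     | yes i≡i₂ = ⊥-elim (i≢i₂ i≡i₂)
    ... | no _    | no _     | no _     = ≡.refl

module _ {N c ℓ} (q′ : ℕ) (F : FiniteField N c ℓ) where
  open FiniteField F
  open FFOps (suc q′) F
  open FieldProperties fld
  open Reciprocity (suc q′) F
  open import Relation.Binary.Reasoning.Setoid setoid
  import Algebra.Solver.CommutativeMonoid *-commutativeMonoid as *-Solver
  open *-Solver using (_⊕_; _⊜_)

  module SelfReciprocalLk {ε a b λ′ : Carrier} {i₁ i₂ j₁ j₂ k : ℕ}
           (a≉0 : ¬ a ≈ 0#) (ε≉0 : ¬ ε ≈ 0#) (0<i₁ : 0 < i₁) (i₁<i₂ : i₁ < i₂)
           (L̃≈λ′L : tildeP (Lk ε a b i₁ i₂ j₁ j₂ k) ≈ₚ scaleP λ′ (Lk ε a b i₁ i₂ j₁ j₂ k)) where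

    L : Poly
    L = Lk ε a b i₁ i₂ j₁ j₂ k

    A B : Carrier
    A = a * ε ^ (j₁ ℕ.* k)
    B = b * ε ^ (j₂ ℕ.* k)

    reciprocal : ∀ {i} → i ≤ i₂ → conj (coeff L (i₂ ∸ i)) ≈ λ′ * coeff L i
    reciprocal = reciprocal-coeff L̃≈λ′L length-Lk

    A≉0 : ¬ A ≈ 0#
    A≉0 = *-nonzero a≉0 (^-nonzero (j₁ ℕ.* k) ε≉0)

    λ′B≈1 : λ′ * B ≈ 1#
    λ′B≈1 = begin
      λ′ * B                     ≡⟨ ≡.cong (λ′ *_) (coeff-Lk-i₂ 0<i₁ i₁<i₂) ⟨
      λ′ * coeff L i₂            ≈⟨ reciprocal ℕP.≤-refl ⟨
      conj (coeff L (i₂ ∸ i₂))   ≡⟨ ≡.cong (conj ∘ coeff L) (ℕP.n∸n≡0 i₂) ⟩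
      conj (coeff L 0)           ≡⟨⟩
      conj 1#                    ≈⟨ 1^n≈1 (suc q′) ⟩
      1#                         ∎

    λ′≉0 : ¬ λ′ ≈ 0#
    λ′≉0 = *≈1⇒nonzero λ′B≈1

    i₂∸i₁≡i₁ : i₂ ∸ i₁ ≡ i₁
    i₂∸i₁≡i₁ with (i₂ ∸ i₁) ℕ.≟ i₁
    ... | yes i₂∸i₁≡i₁ = i₂∸i₁≡i₁
    ... | no  i₂∸i₁≢i₁ = ⊥-elim (*-nonzero λ′≉0 A≉0 (begin
      λ′ * A                     ≡⟨ ≡.cong (λ′ *_) (coeff-Lk-i₁ 0<i₁ i₁<i₂) ⟨
      λ′ * coeff L i₁            ≈⟨ reciprocal (ℕP.<⇒≤ i₁<i₂) ⟨
      conj (coeff L (i₂ ∸ i₁))   ≡⟨ ≡.cong conj (coeff-Lk-other (ℕP.m∸n≤m i₂ i₁) (ℕP.m>n⇒m∸n≢0 i₁<i₂) i₂∸i₁≢i₁ i₂∸i₁≢i₂) ⟩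
      conj 0#                    ≈⟨ 0^suc≈0 q′ ⟩
      0#                         ∎))
      where
      i₂∸i₁≢i₂ : ¬ i₂ ∸ i₁ ≡ i₂
      i₂∸i₁≢i₂ = ℕP.<⇒≢ (ℕP.∸-monoʳ-< 0<i₁ (ℕP.<⇒≤ i₁<i₂))

    middle-exponent : 2 ℕ.* i₁ ≡ i₂
    middle-exponent = n∸m≡m⇒2m≡n i₂∸i₁≡i₁ (ℕP.<⇒≤ i₁<i₂)

    A^q≈λ′A : A * A ^ q′ ≈ λ′ * A
    A^q≈λ′A = begin
      conj A                     ≡⟨ ≡.cong conj (coeff-Lk-i₁ 0<i₁ i₁<i₂) ⟨
      conj (coeff L i₁)          ≡⟨ ≡.cong (conj ∘ coeff L) i₂∸i₁≡i₁ ⟨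
      conj (coeff L (i₂ ∸ i₁))   ≈⟨ reciprocal (ℕP.<⇒≤ i₁<i₂) ⟩
      λ′ * coeff L i₁            ≡⟨ ≡.cong (λ′ *_) (coeff-Lk-i₁ 0<i₁ i₁<i₂) ⟩
      λ′ * A                     ∎

    λ′≈A^[q-1] : λ′ ≈ A ^ q′
    λ′≈A^[q-1] = *-cancelˡ-nonzero A≉0 (trans (*-comm A λ′) (sym A^q≈λ′A))

    module Exponents {d : ℕ} .{{_ : NonZero d}} {m : ℕ} (q+1≡md : suc q′ ℕ.+ 1 ≡ m ℕ.* d)
                     (ε-order : HasOrder ε d) where
      open Order ε-order using (^-injective-%)

      ε^[q+1]≈1 : ε ^ (suc q′ ℕ.+ 1) ≈ 1#
      ε^[q+1]≈1 = trans (reflexive (≡.cong (ε ^_) q+1≡md)) (^-multiple≈1 d m (proj₁ ε-order))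

      b-formula : b ≈ a ^ℤ (0 ⊖ q′) * ε ^ℤ (2 ℕ.* j₁ ℕ.* k ⊖ j₂ ℕ.* k)
      -- b and the claimed value are both inverse to ε^(j₂k) λ′.
      b-formula = *-cancelˡ-nonzero (*-nonzero (^-nonzero (j₂ ℕ.* k) ε≉0) λ′≉0) (trans b-side (sym P-side))
        where
        e₁ e₂ : Carrier
        e₁ = ε ^ (j₁ ℕ.* k)
        e₂ = ε ^ (j₂ ℕ.* k)
        b-side : (e₂ * λ′) * b ≈ 1#
        b-side = trans (*-Solver.solve 3 (λ x y z → (x ⊕ y) ⊕ z ⊜ y ⊕ (z ⊕ x)) refl e₂ λ′ b) λ′B≈1
        exponent : ∀ j k q → 2 ℕ.* j ℕ.* k ℕ.+ j ℕ.* k ℕ.* q ≡ j ℕ.* k ℕ.* (suc q ℕ.+ 1)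
        exponent = solve-∀
        P-side : (e₂ * λ′) * (a ^ℤ (0 ⊖ q′) * ε ^ℤ (2 ℕ.* j₁ ℕ.* k ⊖ j₂ ℕ.* k)) ≈ 1#
        P-side = begin
          (e₂ * λ′) * (a ^ℤ (0 ⊖ q′) * ε ^ℤ (2 ℕ.* j₁ ℕ.* k ⊖ j₂ ℕ.* k))
            ≈⟨ *-congʳ (*-congˡ (trans λ′≈A^[q-1] (^-distrib-* a e₁ q′))) ⟩
          (e₂ * (a ^ q′ * e₁ ^ q′)) * (a ^ℤ (0 ⊖ q′) * ε ^ℤ (2 ℕ.* j₁ ℕ.* k ⊖ j₂ ℕ.* k))
            ≈⟨ *-Solver.solve 5 (λ x y z u v → (x ⊕ (y ⊕ z)) ⊕ (u ⊕ v) ⊜ (u ⊕ y) ⊕ ((v ⊕ x) ⊕ z)) refl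
                 e₂ (a ^ q′) (e₁ ^ q′) (a ^ℤ (0 ⊖ q′)) (ε ^ℤ (2 ℕ.* j₁ ℕ.* k ⊖ j₂ ℕ.* k)) ⟩
          (a ^ℤ (0 ⊖ q′) * a ^ q′) * ((ε ^ℤ (2 ℕ.* j₁ ℕ.* k ⊖ j₂ ℕ.* k) * e₂) * e₁ ^ q′)
            ≈⟨ *-cong (^ℤ-⊖ 0 q′ a≉0) (*-congʳ (^ℤ-⊖ (2 ℕ.* j₁ ℕ.* k) (j₂ ℕ.* k) ε≉0)) ⟩
          1# * (ε ^ (2 ℕ.* j₁ ℕ.* k) * e₁ ^ q′)
            ≈⟨ *-identityˡ _ ⟩
          ε ^ (2 ℕ.* j₁ ℕ.* k) * e₁ ^ q′
            ≈⟨ *-congˡ (^-assocʳ ε (j₁ ℕ.* k) q′) ⟩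
          ε ^ (2 ℕ.* j₁ ℕ.* k) * ε ^ (j₁ ℕ.* k ℕ.* q′)
            ≈⟨ ^-homo-* ε (2 ℕ.* j₁ ℕ.* k) (j₁ ℕ.* k ℕ.* q′) ⟨
          ε ^ (2 ℕ.* j₁ ℕ.* k ℕ.+ j₁ ℕ.* k ℕ.* q′)
            ≡⟨ ≡.cong (ε ^_) (exponent j₁ k q′) ⟩
          ε ^ (j₁ ℕ.* k ℕ.* (suc q′ ℕ.+ 1))
            ≈⟨ ^-multiple≈1 (suc q′ ℕ.+ 1) (j₁ ℕ.* k) ε^[q+1]≈1 ⟩
          1# ∎

      π-formula : ∀ π α → λ′ ^ m ≈ ε ^ π → a ^ (q′ ℕ.* m) ≈ ε ^ α
                → (π ℕ.+ 2 ℕ.* j₁ ℕ.* k ℕ.* m) % d ≡ α % d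
      π-formula π α λ′^m≈ε^π a^[q-1]m≈ε^α = ^-injective-% (begin
        ε ^ (π ℕ.+ n)                                   ≈⟨ ^-homo-* ε π n ⟩
        ε ^ π * ε ^ n                                   ≈⟨ *-congʳ λ′^m≈ε^π ⟨
        λ′ ^ m * ε ^ n                                  ≈⟨ *-congʳ λ′^m≈ε^α*ε^jk[q-1]m ⟩
        (ε ^ α * ε ^ (j₁ ℕ.* k ℕ.* (q′ ℕ.* m))) * ε ^ n ≈⟨ *-assoc _ _ _ ⟩
        ε ^ α * (ε ^ (j₁ ℕ.* k ℕ.* (q′ ℕ.* m)) * ε ^ n) ≈⟨ *-congˡ (^-homo-* ε (j₁ ℕ.* k ℕ.* (q′ ℕ.* m)) n) ⟨
        ε ^ α * ε ^ (j₁ ℕ.* k ℕ.* (q′ ℕ.* m) ℕ.+ n)     ≡⟨ ≡.cong (λ e → ε ^ α * ε ^ e) (exponent j₁ k q′ m) ⟩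
        ε ^ α * ε ^ (j₁ ℕ.* k ℕ.* m ℕ.* (suc q′ ℕ.+ 1)) ≈⟨ *-congˡ (^-multiple≈1 _ (j₁ ℕ.* k ℕ.* m) ε^[q+1]≈1) ⟩
        ε ^ α * 1#                                      ≈⟨ *-identityʳ _ ⟩
        ε ^ α                                           ∎)
        where
        n : ℕ
        n = 2 ℕ.* j₁ ℕ.* k ℕ.* m
        exponent : ∀ j k q m → j ℕ.* k ℕ.* (q ℕ.* m) ℕ.+ 2 ℕ.* j ℕ.* k ℕ.* m ≡ j ℕ.* k ℕ.* m ℕ.* (suc q ℕ.+ 1)
        exponent = solve-∀
        λ′^m≈ε^α*ε^jk[q-1]m : λ′ ^ m ≈ ε ^ α * ε ^ (j₁ ℕ.* k ℕ.* (q′ ℕ.* m))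
        λ′^m≈ε^α*ε^jk[q-1]m = begin
          λ′ ^ m                                       ≈⟨ ^-cong m λ′≈A^[q-1] ⟩
          (A ^ q′) ^ m                                 ≈⟨ ^-assocʳ A q′ m ⟩
          A ^ (q′ ℕ.* m)                               ≈⟨ ^-distrib-* a (ε ^ (j₁ ℕ.* k)) (q′ ℕ.* m) ⟩
          a ^ (q′ ℕ.* m) * (ε ^ (j₁ ℕ.* k)) ^ (q′ ℕ.* m) ≈⟨ *-cong a^[q-1]m≈ε^α (^-assocʳ ε (j₁ ℕ.* k) (q′ ℕ.* m)) ⟩
          ε ^ α * ε ^ (j₁ ℕ.* k ℕ.* (q′ ℕ.* m))        ∎

lemma4p4 : ∀ {c ℓ : Level} (q r d : ℕ) → IsPrimePower q → 1 ≤ r → 1 ≤ d → d ∣ (q ℕ.+ 1)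
  → {{_ : NonZero d}} → (F : FiniteField (q ℕ.* q) c ℓ)
  → let open FiniteField F
        open FFOps q F
        m = (q ℕ.+ 1) / d
    in (ε : Carrier) → HasOrder ε d
    → (a b : Carrier) → ¬ (a ≈ 0#) → ¬ (b ≈ 0#)
    → (i₁ i₂ j₁ j₂ : ℕ) → 0 < i₁ → i₁ < i₂ → i₂ < m → j₁ < d → j₂ < d
    → (k : ℕ) → k < d
    → (λk : Carrier) → Inμ λk
    → InCalL ε m k i₂ λk (Lk ε a b i₁ i₂ j₁ j₂ k)
    → (2 ℕ.* i₁ ≡ i₂)
      × (eVal r 0 i₂ 0 ≡ (+ r) ℤ.- (+ i₂))
      × (b ≈ ((a ^ℤ ((+ 1) ℤ.- (+ q))) * (ε ^ℤ ((((+ 2) ℤ.* (+ j₁)) ℤ.- (+ j₂)) ℤ.* (+ k)))))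
      × (∀ (π α : Fin d) → (λk ^ m) ≈ (ε ^ toℕ π) → (a ^ ((q ℕ.* q ∸ 1) / d)) ≈ (ε ^ toℕ α)
          → (+ d) ℤD.∣ ((+ toℕ π) ℤ.- (((ℤ.- ((+ 2) ℤ.* (+ j₁) ℤ.* (+ k) ℤ.* (+ m))) ℤ.+ (+ toℕ α)))))
-- Of L ∈ 𝓛_k(i₂,0;λk) only the reciprocity L̃ = λk L is needed.
lemma4p4 q r d q-primePower _ _ d∣q+1 F ε ε-order a b a≉0 _ i₁ i₂ j₁ j₂ 0<i₁ i₁<i₂ _ _ _ k _ λk _
         (_ , lift L̃≈λL , _) with primePower⇒suc q-primePower
... | q′ , ≡.refl = middle-exponent , e-value , b-value , π-value
  where
  open FiniteField F
  open FFOps (suc q′) F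
  open FieldProperties fld using (module Order)
  m : ℕ
  m = (suc q′ ℕ.+ 1) / d
  q+1≡md : suc q′ ℕ.+ 1 ≡ m ℕ.* d
  q+1≡md = ≡.sym (m/n*n≡m d∣q+1)
  open SelfReciprocalLk q′ F a≉0 (Order.ε≉0 ε-order) 0<i₁ i₁<i₂ L̃≈λL
  open Exponents {m = m} q+1≡md ε-order

  e-value : eVal r 0 i₂ 0 ≡ + r ℤ.- + i₂
  e-value = ≡.trans (ℤP.+-identityʳ _) (≡.cong (ℤ._- + i₂) (ℤP.+-identityʳ (+ r)))

  b-value : b ≈ a ^ℤ (+ 1 ℤ.- + suc q′) * ε ^ℤ ((+ 2 ℤ.* + j₁ ℤ.- + j₂) ℤ.* + k)
  b-value = trans b-formula (reflexive (≡.sym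
    (≡.cong₂ (λ u v → a ^ℤ u * ε ^ℤ v) (1-[1+n]≡0⊖n q′) ([2m-n]o≡2mo⊖no j₁ j₂ k))))

  π-value : ∀ (π α : Fin d) → λk ^ m ≈ ε ^ toℕ π → a ^ ((suc q′ ℕ.* suc q′ ∸ 1) / d) ≈ ε ^ toℕ α
          → + d ℤD.∣ + toℕ π ℤ.- (ℤ.- (+ 2 ℤ.* + j₁ ℤ.* + k ℤ.* + m) ℤ.+ + toℕ α)
  π-value π α λk^m≈ε^π a^[q²-1]/d≈ε^α =
    ≡.subst (+ d ℤD.∣_) (≡.sym (p-[-2mno+a]≡[p+2mno]-a (toℕ π) j₁ k m (toℕ α)))
      (%≡⇒∣- (π-formula (toℕ π) (toℕ α) λk^m≈ε^π
        (trans (reflexive (≡.cong (a ^_) (≡.sym ([q*q∸1]/d≡[q∸1]*m (suc q′) m d q+1≡md)))) a^[q²-1]/d≈ε^α)))
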